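{- Suppose $|\mathbb{F}|=2$ and $n=3$. Then two distinct anti-flags $A_1,A_2$ of $\mathrm{PG}(2,2)$ are $2$-adjacent if and only if $\{A_1,A_2\}^{\sim_4}$ is non-empty.
   Context: An anti-flag of $\mathrm{PG}(2,2)$ is a pair $(p,\ell)$ of a point $p$ and a line $\ell$ with $p\notin\ell$. For distinct anti-flags $A_1=(p_1,\ell_1)$, $A_2=(p_2,\ell_2)$: $A_1\sim_2 A_2$ ("$2$-adjacent") iff $p_j\in \ell_{3-j}$ for each $j\in\{1,2\}$; $A_1\sim_4A_2$ iff $p_1\ne p_2$, $\ell_1\neq \ell_2$ and $p_j\notin \ell_{3-j}$ for each $j$. $\{A_1,A_2\}^{\sim_4}$ is the set of all anti-flags that are $\sim_4$-related to both $A_1$ and $A_2$. -}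

module Defs where

open import Data.Bool using (Bool; true; false; _∧_; _∨_; _xor_; not; T)
open import Data.Product using (Σ; ∃; _×_; _,_; proj₁; proj₂)
open import Relation.Binary.PropositionalEquality using (_≡_)
open import Relation.Nullary using (¬_)

-- The field F = GF(2) is modelled by Bool (false = 0, true = 1,
-- addition = xor, multiplication = ∧).
-- Vectors of F^3:
record V3 : Set where
  constructor v3
  field
    x y z : Bool

nonzero : V3 → Bool
nonzero (v3 a b c) = a ∨ b ∨ c

dot : V3 → V3 → Bool
dot (v3 a b c) (v3 d e f) = (a ∧ d) xor ((b ∧ e) xor (c ∧ f))

-- PG(2,2): points are the 1-dim subspaces of F^3, i.e. (since F = GF(2))
-- exactly the nonzero vectors; lines are the 2-dim subspaces, each of which
-- is the kernel of a unique nonzero linear form, represented by a nonzero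
-- vector (homogeneous line coordinates).
Point : Set
Point = Σ V3 (λ v → T (nonzero v))

Line : Set
Line = Σ V3 (λ v → T (nonzero v))

_∈ₗ_ : Point → Line → Set
p ∈ₗ ℓ = dot (proj₁ p) (proj₁ ℓ) ≡ false

AntiFlag : Set
AntiFlag = Σ (Point × Line) (λ pl → ¬ (proj₁ pl ∈ₗ proj₂ pl))

pt : AntiFlag → Point
pt A = proj₁ (proj₁ A)

ln : AntiFlag → Line
ln A = proj₂ (proj₁ A)

Distinct : AntiFlag → AntiFlag → Set
Distinct A₁ A₂ = ¬ (proj₁ (pt A₁) ≡ proj₁ (pt A₂) × proj₁ (ln A₁) ≡ proj₁ (ln A₂))

_∼₂_ : AntiFlag → AntiFlag → Set
A₁ ∼₂ A₂ = Distinct A₁ A₂ × (pt A₁ ∈ₗ ln A₂) × (pt A₂ ∈ₗ ln A₁)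

_∼₄_ : AntiFlag → AntiFlag → Set
A₁ ∼₄ A₂ = ¬ (proj₁ (pt A₁) ≡ proj₁ (pt A₂)) × ¬ (proj₁ (ln A₁) ≡ proj₁ (ln A₂))
         × ¬ (pt A₁ ∈ₗ ln A₂) × ¬ (pt A₂ ∈ₗ ln A₁)

CommonFour≠∅ : AntiFlag → AntiFlag → Set
CommonFour≠∅ A₁ A₂ = Σ AntiFlag (λ B → (B ∼₄ A₁) × (B ∼₄ A₂))

{-# OPTIONS --safe #-}
module Submission where

open import Defs
open import Data.Bool using (Bool; true; false; _∧_; _xor_; T)
open import Data.Bool.Properties using (_≟_; ¬-not; not-¬)
open import Data.Product using (_×_; _,_; proj₁; proj₂)
open import Relation.Binary.Definitions using (DecidableEquality)
open import Relation.Binary.PropositionalEquality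
  using (_≡_; _≢_; refl; trans; cong; cong₂; ≢-sym; module ≡-Reasoning)
open import Relation.Nullary.Decidable using (Dec; map′; _×-dec_; _→-dec_; ¬?; T?; toWitness)
open import Relation.Unary using (Decidable)

-- In coordinates over GF(2), the line through two distinct points p, q is p × q.
--
-- If (q, m) ∼₄ (p, ℓ), then ℓ + m vanishes at p and q, so ℓ = m + p × q. Hence
-- for two anti-flags (p₁, ℓ₁), (p₂, ℓ₂) ∼₄-related to (q, m) we get
-- p₁·ℓ₂ = 1 + det(p₁, p₂, q) = p₂·ℓ₁, and det(p₁, p₂, q) = 1 because three
-- distinct points off the line m are never collinear: the third point of the
-- line through two of them is their sum, which lies on m.
--
-- Conversely, if (p₁, ℓ₁) ∼₂ (p₂, ℓ₂), then
-- (p₁ + p₂ + ℓ₁ × ℓ₂ , ℓ₁ + ℓ₂ + p₁ × p₂) is ∼₄-related to both; it is an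
-- anti-flag by the Binet–Cauchy identity
-- (ℓ₁ × ℓ₂)·(p₁ × p₂) = (p₁·ℓ₁)(p₂·ℓ₂) + (p₁·ℓ₂)(p₂·ℓ₁) = 1.

infixl 6 _⊕_
infixl 7 _⨯_ _*ᵛ_
infix 4 _≟ᵛ_

0ᵛ : V3
0ᵛ = v3 false false false

_⊕_ : V3 → V3 → V3
v3 a b c ⊕ v3 d e f = v3 (a xor d) (b xor e) (c xor f)

_*ᵛ_ : Bool → V3 → V3
s *ᵛ v3 a b c = v3 (s ∧ a) (s ∧ b) (s ∧ c)

_⨯_ : V3 → V3 → V3
v3 a b c ⨯ v3 d e f = v3 ((b ∧ f) xor (c ∧ e)) ((c ∧ d) xor (a ∧ f)) ((a ∧ e) xor (b ∧ d))

_≟ᵛ_ : DecidableEquality V3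
v3 a b c ≟ᵛ v3 d e f =
  map′ (λ { (refl , refl , refl) → refl }) (λ { refl → refl , refl , refl })
       (a ≟ d ×-dec b ≟ e ×-dec c ≟ f)

∀-Bool? : {P : Bool → Set} → Decidable P → Dec (∀ b → P b)
∀-Bool? P? = map′ (λ { (t , f) true → t ; (t , f) false → f }) (λ h → h true , h false)
                  (P? true ×-dec P? false)

∀-V3? : {P : V3 → Set} → Decidable P → Dec (∀ v → P v)
∀-V3? P? = map′ (λ h v → h (V3.x v) (V3.y v) (V3.z v)) (λ h a b c → h (v3 a b c))
                (∀-Bool? λ a → ∀-Bool? λ b → ∀-Bool? λ c → P? (v3 a b c))

·-comm : ∀ u v → dot u v ≡ dot v u
·-comm = toWitness {a? = ∀-V3? λ u → ∀-V3? λ v → _ ≟ _} _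

·-sym : ∀ u v {b} → dot u v ≡ b → dot v u ≡ b
·-sym u v = trans (·-comm v u)

·-distribˡ-⊕ : ∀ u v w → dot u (v ⊕ w) ≡ dot u v xor dot u w
·-distribˡ-⊕ = toWitness {a? = ∀-V3? λ u → ∀-V3? λ v → ∀-V3? λ w → _ ≟ _} _

·-distribʳ-⊕ : ∀ u v w → dot (u ⊕ v) w ≡ dot u w xor dot v w
·-distribʳ-⊕ = toWitness {a? = ∀-V3? λ u → ∀-V3? λ v → ∀-V3? λ w → _ ≟ _} _

·-distribˡ-⊕₃ : ∀ u v w t → dot u (v ⊕ w ⊕ t) ≡ (dot u v xor dot u w) xor dot u t
·-distribˡ-⊕₃ u v w t = trans (·-distribˡ-⊕ u (v ⊕ w) t) (cong (_xor dot u t) (·-distribˡ-⊕ u v w))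

·-distribʳ-⊕₃ : ∀ u v w t → dot (u ⊕ v ⊕ w) t ≡ (dot u t xor dot v t) xor dot w t
·-distribʳ-⊕₃ u v w t = trans (·-distribʳ-⊕ (u ⊕ v) w t) (cong (_xor dot w t) (·-distribʳ-⊕ u v t))

⨯-orthogonalˡ : ∀ u v → dot u (u ⨯ v) ≡ false
⨯-orthogonalˡ = toWitness {a? = ∀-V3? λ u → ∀-V3? λ v → _ ≟ _} _

⨯-orthogonalʳ : ∀ u v → dot v (u ⨯ v) ≡ false
⨯-orthogonalʳ = toWitness {a? = ∀-V3? λ u → ∀-V3? λ v → _ ≟ _} _

·-⨯-swap : ∀ u v w → dot u (v ⨯ w) ≡ dot v (u ⨯ w)
·-⨯-swap = toWitness {a? = ∀-V3? λ u → ∀-V3? λ v → ∀-V3? λ w → _ ≟ _} _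

⨯-distribʳ-⊕ : ∀ u v w → (u ⊕ v) ⨯ w ≡ u ⨯ w ⊕ v ⨯ w
⨯-distribʳ-⊕ = toWitness {a? = ∀-V3? λ u → ∀-V3? λ v → ∀-V3? λ w → _ ≟ᵛ _} _

⨯-⨯-expand : ∀ u v w → u ⨯ (v ⨯ w) ≡ dot w u *ᵛ v ⊕ dot v u *ᵛ w
⨯-⨯-expand = toWitness {a? = ∀-V3? λ u → ∀-V3? λ v → ∀-V3? λ w → _ ≟ᵛ _} _

binet-cauchy : ∀ a b c d → dot (a ⨯ b) (c ⨯ d) ≡ (dot a c ∧ dot b d) xor (dot a d ∧ dot b c)
binet-cauchy = toWitness {a? = ∀-V3? λ a → ∀-V3? λ b → ∀-V3? λ c → ∀-V3? λ d → _ ≟ _} _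

⊕-self : ∀ v → v ⊕ v ≡ 0ᵛ
⊕-self = toWitness {a? = ∀-V3? λ v → _ ≟ᵛ _} _

⊕-≡-move : ∀ {u v w} → u ⊕ v ≡ w → v ≡ u ⊕ w
⊕-≡-move {u} {v} {w} =
  toWitness {a? = ∀-V3? λ u → ∀-V3? λ v → ∀-V3? λ w → (u ⊕ v ≟ᵛ w) →-dec (v ≟ᵛ u ⊕ w)} _ u v w

⊕-nonzero : ∀ {u v} → u ≢ v → T (nonzero (u ⊕ v))
⊕-nonzero {u} {v} =
  toWitness {a? = ∀-V3? λ u → ∀-V3? λ v → ¬? (u ≟ᵛ v) →-dec T? (nonzero (u ⊕ v))} _ u v

dot-nonzeroˡ : ∀ u v → dot u v ≡ true → T (nonzero u)
dot-nonzeroˡ =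
  toWitness {a? = ∀-V3? λ u → ∀-V3? λ v → (dot u v ≟ true) →-dec T? (nonzero u)} _

dot-nonzeroʳ : ∀ u v → dot u v ≡ true → T (nonzero v)
dot-nonzeroʳ u v u·v = dot-nonzeroˡ v u (·-sym u v u·v)

≢0ᵛ⇒nonzero : ∀ {v} → v ≢ 0ᵛ → T (nonzero v)
≢0ᵛ⇒nonzero {v} = toWitness {a? = ∀-V3? λ v → ¬? (v ≟ᵛ 0ᵛ) →-dec T? (nonzero v)} _ v

-- Over GF(2) the only nonzero scalar is 1, so parallel nonzero vectors coincide.
parallel⇒≡ : ∀ {u v} → T (nonzero u) → T (nonzero v) → u ⨯ v ≡ 0ᵛ → u ≡ v
parallel⇒≡ {u} {v} =
  toWitness {a? = ∀-V3? λ u → ∀-V3? λ v →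
                  T? (nonzero u) →-dec T? (nonzero v) →-dec (u ⨯ v ≟ᵛ 0ᵛ) →-dec (u ≟ᵛ v)} _ u v

⨯-nonzero : ∀ {u v} → T (nonzero u) → T (nonzero v) → u ≢ v → T (nonzero (u ⨯ v))
⨯-nonzero u≠0 v≠0 u≢v = ≢0ᵛ⇒nonzero λ u⨯v≡0 → u≢v (parallel⇒≡ u≠0 v≠0 u⨯v≡0)

off-both⇒on-⊕ : ∀ u v w → dot u v ≡ true → dot u w ≡ true → dot u (v ⊕ w) ≡ false
off-both⇒on-⊕ u v w u·v u·w = trans (·-distribˡ-⊕ u v w) (cong₂ _xor_ u·v u·w)

line-through : ∀ {p q n} → T (nonzero p) → T (nonzero q) → p ≢ q → T (nonzero n)
             → dot p n ≡ false → dot q n ≡ false → n ≡ p ⨯ q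
line-through {p} {q} {n} p≠0 q≠0 p≢q n≠0 p∈n q∈n =
  parallel⇒≡ {n} {p ⨯ q} n≠0 (⨯-nonzero p≠0 q≠0 p≢q) (begin
    n ⨯ (p ⨯ q)                  ≡⟨ ⨯-⨯-expand n p q ⟩
    dot q n *ᵛ p ⊕ dot p n *ᵛ q  ≡⟨ cong₂ (λ s t → s *ᵛ p ⊕ t *ᵛ q) q∈n p∈n ⟩
    0ᵛ                           ∎)
  where open ≡-Reasoning

collinear⇒≡⊕ : ∀ {a b c} → T (nonzero a) → T (nonzero b) → T (nonzero c)
             → a ≢ b → a ≢ c → c ≢ b → dot c (a ⨯ b) ≡ false → c ≡ a ⊕ b
collinear⇒≡⊕ {a} {b} {c} a≠0 b≠0 c≠0 a≢b a≢c c≢b c∈ab =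
  ⊕-≡-move {a} {c} {b} (parallel⇒≡ {a ⊕ c} {b} (⊕-nonzero a≢c) b≠0 (begin
    (a ⊕ c) ⨯ b    ≡⟨ ⨯-distribʳ-⊕ a c b ⟩
    a ⨯ b ⊕ c ⨯ b  ≡⟨ cong (_⊕ c ⨯ b) ab≡cb ⟩
    c ⨯ b ⊕ c ⨯ b  ≡⟨ ⊕-self (c ⨯ b) ⟩
    0ᵛ             ∎))
  where
  open ≡-Reasoning
  ab≡cb : a ⨯ b ≡ c ⨯ b
  ab≡cb = line-through c≠0 b≠0 c≢b (⨯-nonzero a≠0 b≠0 a≢b) c∈ab (⨯-orthogonalʳ a b)

off-line-noncollinear : ∀ {p₁ p₂ q} m → T (nonzero p₁) → T (nonzero p₂) → T (nonzero q)
  → p₁ ≢ p₂ → q ≢ p₁ → q ≢ p₂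
  → dot p₁ m ≡ true → dot p₂ m ≡ true → dot q m ≡ true → dot p₁ (p₂ ⨯ q) ≡ true
off-line-noncollinear {p₁} {p₂} {q} m p₁≠0 p₂≠0 q≠0 p₁≢p₂ q≢p₁ q≢p₂ p₁∉m p₂∉m q∉m =
  ¬-not λ collinear → not-¬ p₁∉m (begin
    dot p₁ m              ≡⟨ cong (λ p → dot p m) (collinear⇒≡⊕ p₂≠0 q≠0 p₁≠0
                                    (≢-sym q≢p₂) (≢-sym p₁≢p₂) (≢-sym q≢p₁) collinear) ⟩
    dot (p₂ ⊕ q) m        ≡⟨ ·-distribʳ-⊕ p₂ q m ⟩
    dot p₂ m xor dot q m  ≡⟨ cong₂ _xor_ p₂∉m q∉m ⟩
    false                 ∎)
  where open ≡-Reasoning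

off-witness-line : ∀ x₁ x₂ a₁ a₂ → dot x₁ a₁ ≡ true → dot x₂ a₂ ≡ true
                 → dot x₁ a₂ ≡ false → dot x₂ a₁ ≡ false
                 → dot x₁ (a₁ ⊕ a₂ ⊕ x₁ ⨯ x₂) ≡ true × dot x₂ (a₁ ⊕ a₂ ⊕ x₁ ⨯ x₂) ≡ true
off-witness-line x₁ x₂ a₁ a₂ x₁·a₁ x₂·a₂ x₁·a₂ x₂·a₁ =
    trans (·-distribˡ-⊕₃ x₁ a₁ a₂ (x₁ ⨯ x₂))
          (cong₂ _xor_ (cong₂ _xor_ x₁·a₁ x₁·a₂) (⨯-orthogonalˡ x₁ x₂))
  , trans (·-distribˡ-⊕₃ x₂ a₁ a₂ (x₁ ⨯ x₂))
          (cong₂ _xor_ (cong₂ _xor_ x₂·a₁ x₂·a₂) (⨯-orthogonalʳ x₁ x₂))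

module ∼₂-Witness (p₁ p₂ ℓ₁ ℓ₂ : V3)
  (p₁∉ℓ₁ : dot p₁ ℓ₁ ≡ true) (p₂∉ℓ₂ : dot p₂ ℓ₂ ≡ true)
  (p₁∈ℓ₂ : dot p₁ ℓ₂ ≡ false) (p₂∈ℓ₁ : dot p₂ ℓ₁ ≡ false) where

  q m : V3
  q = p₁ ⊕ p₂ ⊕ ℓ₁ ⨯ ℓ₂
  m = ℓ₁ ⊕ ℓ₂ ⊕ p₁ ⨯ p₂

  ℓ₁·q×ℓ₂·q : dot ℓ₁ q ≡ true × dot ℓ₂ q ≡ true
  ℓ₁·q×ℓ₂·q = off-witness-line ℓ₁ ℓ₂ p₁ p₂ (·-sym p₁ ℓ₁ p₁∉ℓ₁) (·-sym p₂ ℓ₂ p₂∉ℓ₂)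
                                          (·-sym p₂ ℓ₁ p₂∈ℓ₁) (·-sym p₁ ℓ₂ p₁∈ℓ₂)

  q∉ℓ₁ : dot q ℓ₁ ≡ true
  q∉ℓ₁ = ·-sym ℓ₁ q (proj₁ ℓ₁·q×ℓ₂·q)

  q∉ℓ₂ : dot q ℓ₂ ≡ true
  q∉ℓ₂ = ·-sym ℓ₂ q (proj₂ ℓ₁·q×ℓ₂·q)

  p₁∉m×p₂∉m : dot p₁ m ≡ true × dot p₂ m ≡ true
  p₁∉m×p₂∉m = off-witness-line p₁ p₂ ℓ₁ ℓ₂ p₁∉ℓ₁ p₂∉ℓ₂ p₁∈ℓ₂ p₂∈ℓ₁

  p₁∉m : dot p₁ m ≡ true
  p₁∉m = proj₁ p₁∉m×p₂∉m

  p₂∉m : dot p₂ m ≡ true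
  p₂∉m = proj₂ p₁∉m×p₂∉m

  q∉m : dot q m ≡ true
  q∉m = begin
    dot q m                                ≡⟨ ·-distribˡ-⊕₃ q ℓ₁ ℓ₂ n ⟩
    (dot q ℓ₁ xor dot q ℓ₂) xor dot q n    ≡⟨ cong₂ (λ s t → (s xor t) xor dot q n) q∉ℓ₁ q∉ℓ₂ ⟩
    dot q n                                ≡⟨ ·-distribʳ-⊕₃ p₁ p₂ r n ⟩
    (dot p₁ n xor dot p₂ n) xor dot r n    ≡⟨ cong₂ (λ s t → (s xor t) xor dot r n)
                                                    (⨯-orthogonalˡ p₁ p₂) (⨯-orthogonalʳ p₁ p₂) ⟩
    dot r n                                ≡⟨ ·-comm r n ⟩
    dot n r                                ≡⟨ binet-cauchy p₁ p₂ ℓ₁ ℓ₂ ⟩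
    (dot p₁ ℓ₁ ∧ dot p₂ ℓ₂) xor (dot p₁ ℓ₂ ∧ dot p₂ ℓ₁)
                                           ≡⟨ cong₂ _xor_ (cong₂ _∧_ p₁∉ℓ₁ p₂∉ℓ₂)
                                                          (cong₂ _∧_ p₁∈ℓ₂ p₂∈ℓ₁) ⟩
    true                                   ∎
    where
    open ≡-Reasoning
    r n : V3
    r = ℓ₁ ⨯ ℓ₂
    n = p₁ ⨯ p₂

ptᵛ : AntiFlag → V3
ptᵛ A = proj₁ (pt A)

lnᵛ : AntiFlag → V3
lnᵛ A = proj₁ (ln A)

pt-off-ln : (A : AntiFlag) → dot (ptᵛ A) (lnᵛ A) ≡ true
pt-off-ln A = ¬-not (proj₂ A)

antiFlag : ∀ p ℓ → dot p ℓ ≡ true → AntiFlag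
antiFlag p ℓ p∉ℓ = ((p , dot-nonzeroˡ p ℓ p∉ℓ) , (ℓ , dot-nonzeroʳ p ℓ p∉ℓ)) , not-¬ p∉ℓ

separated-by-line : ∀ {u v} w → dot u w ≡ true → dot v w ≡ false → u ≢ v
separated-by-line w u∉w v∈w refl = not-¬ u∉w v∈w

separated-by-point : ∀ w {u v} → dot w u ≡ true → dot w v ≡ false → u ≢ v
separated-by-point w w∉u w∈v refl = not-¬ w∉u w∈v

∼₂⇒common-∼₄ : ∀ A₁ A₂ → A₁ ∼₂ A₂ → CommonFour≠∅ A₁ A₂
∼₂⇒common-∼₄ A₁ A₂ (_ , p₁∈ℓ₂ , p₂∈ℓ₁) =
    antiFlag q m q∉m
  , (separated-by-line ℓ₂ q∉ℓ₂ p₁∈ℓ₂ , separated-by-point p₂ p₂∉m p₂∈ℓ₁ , not-¬ q∉ℓ₁ , not-¬ p₁∉m)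
  , (separated-by-line ℓ₁ q∉ℓ₁ p₂∈ℓ₁ , separated-by-point p₁ p₁∉m p₁∈ℓ₂ , not-¬ q∉ℓ₂ , not-¬ p₂∉m)
  where
  p₁ p₂ ℓ₁ ℓ₂ : V3
  p₁ = ptᵛ A₁
  p₂ = ptᵛ A₂
  ℓ₁ = lnᵛ A₁
  ℓ₂ = lnᵛ A₂
  open ∼₂-Witness p₁ p₂ ℓ₁ ℓ₂ (pt-off-ln A₁) (pt-off-ln A₂) p₁∈ℓ₂ p₂∈ℓ₁

∼₄⇒ln≡ : ∀ B A → B ∼₄ A → lnᵛ A ≡ lnᵛ B ⊕ ptᵛ A ⨯ ptᵛ B
∼₄⇒ln≡ B A (q≢p , m≢ℓ , q∉ℓ , p∉m) =
  ⊕-≡-move {lnᵛ B} {lnᵛ A} {ptᵛ A ⨯ ptᵛ B}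
    (line-through (proj₂ (pt A)) (proj₂ (pt B)) (≢-sym q≢p) (⊕-nonzero m≢ℓ)
      (off-both⇒on-⊕ (ptᵛ A) (lnᵛ B) (lnᵛ A) (¬-not p∉m) (pt-off-ln A))
      (off-both⇒on-⊕ (ptᵛ B) (lnᵛ B) (lnᵛ A) (pt-off-ln B) (¬-not q∉ℓ)))

common-∼₄⇒∈ : ∀ B A₁ A₂ → B ∼₄ A₁ → B ∼₄ A₂
            → dot (ptᵛ A₁) (ptᵛ A₂ ⨯ ptᵛ B) ≡ true → pt A₁ ∈ₗ ln A₂
common-∼₄⇒∈ B A₁ A₂ (_ , _ , _ , p₁∉m) B∼A₂ p₁∉p₂q = begin
  dot p₁ (lnᵛ A₂)               ≡⟨ cong (dot p₁) (∼₄⇒ln≡ B A₂ B∼A₂) ⟩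
  dot p₁ (m ⊕ p₂ ⨯ q)           ≡⟨ ·-distribˡ-⊕ p₁ m (p₂ ⨯ q) ⟩
  dot p₁ m xor dot p₁ (p₂ ⨯ q)  ≡⟨ cong₂ _xor_ (¬-not p₁∉m) p₁∉p₂q ⟩
  false                         ∎
  where
  open ≡-Reasoning
  p₁ p₂ q m : V3
  p₁ = ptᵛ A₁
  p₂ = ptᵛ A₂
  q = ptᵛ B
  m = lnᵛ B

common-∼₄⇒∼₂ : ∀ A₁ A₂ → Distinct A₁ A₂ → CommonFour≠∅ A₁ A₂ → A₁ ∼₂ A₂
common-∼₄⇒∼₂ A₁ A₂ A₁≠A₂ (B , B∼A₁@(q≢p₁ , _ , _ , p₁∉m) , B∼A₂@(q≢p₂ , _ , _ , p₂∉m)) =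
    A₁≠A₂
  , common-∼₄⇒∈ B A₁ A₂ B∼A₁ B∼A₂ p₁∉p₂q
  , common-∼₄⇒∈ B A₂ A₁ B∼A₂ B∼A₁ (trans (·-⨯-swap p₂ p₁ q) p₁∉p₂q)
  where
  open ≡-Reasoning
  p₁ p₂ q m : V3
  p₁ = ptᵛ A₁
  p₂ = ptᵛ A₂
  q = ptᵛ B
  m = lnᵛ B

  p₁≢p₂ : p₁ ≢ p₂
  p₁≢p₂ p₁≡p₂ = A₁≠A₂ (p₁≡p₂ , (begin
    lnᵛ A₁      ≡⟨ ∼₄⇒ln≡ B A₁ B∼A₁ ⟩
    m ⊕ p₁ ⨯ q  ≡⟨ cong (λ p → m ⊕ p ⨯ q) p₁≡p₂ ⟩
    m ⊕ p₂ ⨯ q  ≡⟨ ∼₄⇒ln≡ B A₂ B∼A₂ ⟨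
    lnᵛ A₂      ∎))

  p₁∉p₂q : dot p₁ (p₂ ⨯ q) ≡ true
  p₁∉p₂q = off-line-noncollinear m (proj₂ (pt A₁)) (proj₂ (pt A₂)) (proj₂ (pt B))
             p₁≢p₂ q≢p₁ q≢p₂ (¬-not p₁∉m) (¬-not p₂∉m) (pt-off-ln B)

proposition4 : (A₁ A₂ : AntiFlag) → Distinct A₁ A₂
    → (A₁ ∼₂ A₂ → CommonFour≠∅ A₁ A₂) × (CommonFour≠∅ A₁ A₂ → A₁ ∼₂ A₂)
proposition4 A₁ A₂ A₁≠A₂ = ∼₂⇒common-∼₄ A₁ A₂ , common-∼₄⇒∼₂ A₁ A₂ A₁≠A₂
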